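{- Let $\gamma=((i_1\,j_1),\ldots,(i_k\,j_k))\in\Sigma_n(k)$ and $l\in\{1,\ldots,k\}$. Then: 1. $i_l$ is smaller than every element of $C_{\gamma_{l-1}}(j_l)$, and $i_l$ is the largest element of $C_{\gamma_{l-1}}(i_l)$ which is smaller than every element of $C_{\gamma_{l-1}}(j_l)$. 2. $j_l=\max C_{\gamma_{l-1}}(j_l)$. 3. $i_l$ is smaller than every element of $C_{\gamma_{l-1}}(i_l+1)$. 4. If $i_l+1\notin\{i_1,\ldots,i_{l-1}\}$, then $C_{\gamma_{l-1}}(i_l+1)=\{i_l+1\}$. 5. If $k=n-1$, $i_l=\max\{i_1,\ldots,i_{n-1}\}$ and $l=\max\{s\in\{1,\ldots,k\}: i_s=i_l\}$, then $j_l=i_l+1$.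
   Context: Permutations are multiplied with the right factor applied first. $\mathsf T_n$ is the set of transpositions of $\{1,\ldots,n\}$; a transposition is written $(i\,j)$ with $i<j$. For $\sigma\in\mathfrak S_n$, $|\sigma|=n-(\text{number of cycles of }\sigma\text{, fixed points included})$, and $\sigma_1\preccurlyeq\sigma_2$ iff $|\sigma_2|=|\sigma_1|+|\sigma_1^{ -1}\sigma_2|$. $\Sigma_n(k)=\{(\tau_1,\ldots,\tau_k)\in(\mathsf T_n)^k : |\tau_1\cdots\tau_k|=k,\ \tau_1\cdots\tau_k\preccurlyeq(1\,2\,\cdots\,n)\}$. For $\gamma=(\tau_1,\ldots,\tau_k)$, $\gamma_l=\tau_1\cdots\tau_l$ ($\gamma_0=\mathrm{id}$). For a permutation $\pi$ and $x\in\{1,\ldots,n\}$, $C_\pi(x)$ denotes the set of elements of the cycle of $\pi$ containing $x$. -}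

module Defs where

open import Data.Nat as ℕ using (ℕ; zero; suc; _∸_; _+_)
open import Data.Fin as Fin using (Fin; zero; suc; toℕ; fromℕ; inject₁; _<_; _≤_)
open import Data.Fin.Properties using (all?; _≤?_)
open import Data.Fin.Permutation using (Permutation′; permutation; _⟨$⟩ʳ_; _∘ₚ_; flip; transpose)
  renaming (id to idₚ)
open import Data.Product using (Σ; ∃; _×_; _,_; proj₁; proj₂)
open import Data.List as List using (List; []; _∷_; length; filter; take)
open import Data.Vec as Vec using (Vec; lookup; toList)
open import Relation.Nullary using (Dec)
open import Relation.Binary.PropositionalEquality using (_≡_; refl; cong)

-- Permutations of {1,…,n}, encoded as Fin n (element i+1 ↔ Fin index i;
-- the order on Fin n is the order on toℕ, so it matches the usual order).

Perm : ℕ → Set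
Perm = Permutation′

-- Product with the RIGHT factor applied first:  (σ · ρ) x = σ (ρ x).
-- (stdlib's  π₁ ∘ₚ π₂  applies π₁ first.)
infixl 7 _·_
_·_ : ∀ {n} → Perm n → Perm n → Perm n
σ · ρ = ρ ∘ₚ σ

iter : ∀ {n} → Perm n → ℕ → Fin n → Fin n
iter σ zero    x = x
iter σ (suc m) x = σ ⟨$⟩ʳ iter σ m x

InCycle : ∀ {n} → Perm n → Fin n → Fin n → Set
InCycle σ x y = ∃ λ (m : ℕ) → iter σ m x ≡ y

-- x is the smallest element of its cycle (the orbit of x under a
-- permutation of n points is { σ^m x : m < n })
CycleMin : ∀ {n} → Perm n → Fin n → Set
CycleMin {n} σ x = ∀ (m : Fin n) → x ≤ iter σ (toℕ m) x

-- number of cycles of σ (fixed points included) = number of cycle minima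
numCycles : ∀ {n} → Perm n → ℕ
numCycles {n} σ = length (filter cycleMin? (List.allFin n))
  where
  cycleMin? : (x : Fin n) → Dec (CycleMin σ x)
  cycleMin? x = all? {n = n} (λ m → x ≤? iter σ (toℕ m) x)

∣_∣ₚ : ∀ {n} → Perm n → ℕ
∣_∣ₚ {n} σ = n ∸ numCycles σ

_≼_ : ∀ {n} → Perm n → Perm n → Set
σ₁ ≼ σ₂ = ∣ σ₂ ∣ₚ ≡ ∣ σ₁ ∣ₚ + ∣ flip σ₁ · σ₂ ∣ₚ

-- The long cycle (1 2 ⋯ n):  x ↦ x+1 for x < n,  n ↦ 1.

up : ∀ {m} → Fin (suc m) → Fin (suc m)
up {zero}  zero    = zero
up {suc m} zero    = suc zero
up {suc m} (suc x) with up {m} x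
... | zero  = zero
... | suc y = suc (suc y)

down : ∀ {m} → Fin (suc m) → Fin (suc m)
down {m} zero    = fromℕ m
down     (suc y) = inject₁ y

up-last : ∀ m → up (fromℕ m) ≡ zero
up-last zero = refl
up-last (suc m) rewrite up-last m = refl

up-inject : ∀ {m} (y : Fin m) → up (inject₁ y) ≡ suc y
up-inject {suc m} zero = refl
up-inject {suc m} (suc y) rewrite up-inject y = refl

up-down : ∀ {m} (y : Fin (suc m)) → up (down y) ≡ y
up-down {m} zero = up-last m
up-down (suc y) = up-inject y

down-up : ∀ {m} (x : Fin (suc m)) → down (up x) ≡ x
down-up {zero} zero = refl
down-up {suc m} zero = refl
down-up {suc m} (suc x) with up {m} x | down-up {m} x
... | zero  | eq = cong suc eq
... | suc y | eq = cong suc eq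

longCycle : ∀ n → Perm n
longCycle zero    = idₚ
longCycle (suc m) = permutation up down up-down down-up

-- Tuples of transpositions.  A transposition (i j), i < j, is recorded by
-- the pair (i , j); γ = ((i₁ j₁),…,(i_k j_k)) is a Vec of k such pairs.

transp : ∀ {n} → Fin n × Fin n → Perm n
transp (i , j) = transpose i j

prodL : ∀ {n} → List (Fin n × Fin n) → Perm n
prodL []       = idₚ
prodL (t ∷ ts) = transp t · prodL ts

partialProd : ∀ {n k} → Vec (Fin n × Fin n) k → ℕ → Perm n
partialProd γ l = prodL (take l (toList γ))

InΣ : ∀ n k → Vec (Fin n × Fin n) k → Set
InΣ n k γ =
  (∀ (s : Fin k) → proj₁ (lookup γ s) < proj₂ (lookup γ s))
  × ∣ partialProd γ k ∣ₚ ≡ k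
  × partialProd γ k ≼ longCycle n

module Submission where

open import Defs
open import Data.Nat using (ℕ; _∸_; _+_) renaming (_<_ to _<ℕ_)
open import Data.Fin using (Fin; toℕ; _<_; _≤_)
open import Data.Vec using (Vec; lookup)
open import Data.Product using (_×_; _,_; proj₁; proj₂)
open import Function.Bundles using (_⇔_)
open import Relation.Binary.PropositionalEquality using (_≡_; _≢_)

import Data.Nat as ℕ
open import Data.Nat using (zero; suc; z≤n; s≤s) renaming (_≤_ to _≤ℕ_)
import Data.Nat.Properties as ℕₚ
open import Data.Fin using (zero; suc; fromℕ<)
import Data.Fin.Properties as Finₚ
open import Data.Fin.Properties
  using (_≟_; _≤?_; all?; any?; suc-injective; pigeonhole; toℕ<n; toℕ-fromℕ<; toℕ-fromℕ; toℕ-inject₁)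
import Data.Fin.Permutation.Components as PC
open import Data.Fin.Permutation using (_⟨$⟩ʳ_; _⟨$⟩ˡ_; inverseˡ; flip)
open import Data.Vec using (toList) renaming ([] to []ᵥ; _∷_ to _∷ᵥ_)
open import Data.List using (List; []; _∷_; _++_; take; allFin; length; filter; tabulate)
open import Data.List.Relation.Unary.All using (All; []; _∷_)
import Data.List.Relation.Unary.All as All
import Data.List.Relation.Unary.All.Properties as AllP
open import Data.List.Relation.Unary.Any using (here; there)
open import Data.List.Membership.Propositional using (_∈_)
open import Data.List.Membership.Propositional.Properties using (∈-allFin)
open import Data.Product using (∃)
open import Data.Sum using (_⊎_; inj₁; inj₂)
open import Data.Empty using (⊥; ⊥-elim)
open import Function.Bundles using (mk⇔)
open import Level using (0ℓ)
open import Relation.Binary.Definitions using (tri<; tri≈; tri>)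
open import Relation.Binary.PropositionalEquality using (refl; cong; cong₂; sym; trans; subst; module ≡-Reasoning)
open import Relation.Nullary using (Dec; yes; no; ¬_)
open import Relation.Nullary.Decidable using (_×-dec_; _⊎-dec_; _→-dec_; ¬?)
open import Relation.Unary using (Pred; Decidable)

-- 1. The number of cycles is the number of cycle minima.  Multiplying by a
--    transposition raises it by at most one, and does not raise it when the
--    two points lie in different cycles (module Surgery).
-- 2. For γ ∈ Σ_n(k) the Kreweras complements κ_l = c⁻¹ γ_l have exactly l + 1
--    cycles, so every τ_l splits a cycle of κ_{l-1}.  An invariant (Rotates)
--    says that κ_l rotates the blocks cut out by the arcs of γ_l; hence no
--    earlier arc separates i_l from j_l: the arcs are non-crossing
--    (module MinimalFactorization).
-- 3. Consequently every earlier transposition, and so γ_{l-1}, maps the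
--    interval (i_l , j_l] into itself (module Step).  Parts 1–4 follow from
--    this; part 5 uses that for k = n - 1 the product γ_k is an n-cycle, which
--    fixes no point, whereas j_l ≠ i_l + 1 would leave i_l + 1 untouched.

-- Cycle numbers are counts of cycle minima, so all estimates on numbers of
-- cycles reduce to the following elementary facts about counting.

countStep : ∀ {A : Set} → Dec A → ℕ → ℕ
countStep (yes _) m = suc m
countStep (no _)  m = m

count : ∀ {n} {P : Pred (Fin n) 0ℓ} → Decidable P → ℕ
count {zero}  P? = 0
count {suc n} P? = countStep (P? zero) (count (λ x → P? (suc x)))

_─_ : ∀ {n} {P : Pred (Fin n) 0ℓ} → Decidable P → (a : Fin n) → Decidable (λ x → P x × x ≢ a)
(P? ─ a) x = P? x ×-dec ¬? (x ≟ a)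

count-mono : ∀ {n} {P Q : Pred (Fin n) 0ℓ} (P? : Decidable P) (Q? : Decidable Q) →
             (∀ x → P x → Q x) → count P? ≤ℕ count Q?
count-mono {zero}  P? Q? P⊆Q = z≤n
count-mono {suc n} {P} {Q} P? Q? P⊆Q =
  step (P? zero) (Q? zero) (count-mono (λ x → P? (suc x)) (λ x → Q? (suc x)) (λ x → P⊆Q (suc x)))
  where
  step : ∀ {a b} (p : Dec (P zero)) (q : Dec (Q zero)) → a ≤ℕ b → countStep p a ≤ℕ countStep q b
  step (yes _) (yes _) a≤b = s≤s a≤b
  step (yes p) (no ¬q) a≤b = ⊥-elim (¬q (P⊆Q zero p))
  step (no _)  (yes _) a≤b = ℕₚ.m≤n⇒m≤1+n a≤b
  step (no _)  (no _)  a≤b = a≤b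

count-cong : ∀ {n} {P Q : Pred (Fin n) 0ℓ} (P? : Decidable P) (Q? : Decidable Q) →
             (∀ x → P x → Q x) → (∀ x → Q x → P x) → count P? ≡ count Q?
count-cong P? Q? P⊆Q Q⊆P = ℕₚ.≤-antisym (count-mono P? Q? P⊆Q) (count-mono Q? P? Q⊆P)

count-≤ : ∀ {n} {P : Pred (Fin n) 0ℓ} (P? : Decidable P) → count P? ≤ℕ n
count-≤ {zero}  P? = z≤n
count-≤ {suc n} P? = step (P? zero) (count-≤ (λ x → P? (suc x)))
  where
  step : ∀ {A : Set} {a} (p : Dec A) → a ≤ℕ n → countStep p a ≤ℕ suc n
  step (yes _) a≤n = s≤s a≤n
  step (no _)  a≤n = ℕₚ.m≤n⇒m≤1+n a≤n

count-∪ : ∀ {n} {P Q R : Pred (Fin n) 0ℓ} (P? : Decidable P) (Q? : Decidable Q) (R? : Decidable R) →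
          (∀ x → P x → Q x ⊎ R x) → count P? ≤ℕ count Q? + count R?
count-∪ {zero}  P? Q? R? cover = z≤n
count-∪ {suc n} {P} {Q} {R} P? Q? R? cover =
  step (P? zero) (Q? zero) (R? zero)
       (count-∪ (λ x → P? (suc x)) (λ x → Q? (suc x)) (λ x → R? (suc x)) (λ x → cover (suc x)))
  where
  +1ʳ : ∀ {a b c} → a ≤ℕ b + c → a ≤ℕ b + suc c
  +1ʳ {a} {b} {c} a≤ = ℕₚ.≤-trans a≤ (ℕₚ.+-monoʳ-≤ b (ℕₚ.n≤1+n c))
  step : ∀ {a b c} (p : Dec (P zero)) (q : Dec (Q zero)) (r : Dec (R zero)) →
         a ≤ℕ b + c → countStep p a ≤ℕ countStep q b + countStep r c
  step         (yes _) (yes _) (yes _) a≤ = s≤s (+1ʳ a≤)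
  step         (yes _) (yes _) (no _)  a≤ = s≤s a≤
  step {b = b} (yes _) (no _)  (yes _) a≤ = ℕₚ.≤-trans (s≤s a≤) (ℕₚ.≤-reflexive (sym (ℕₚ.+-suc b _)))
  step         (yes p) (no ¬q) (no ¬r) a≤ with cover zero p
  ... | inj₁ q = ⊥-elim (¬q q)
  ... | inj₂ r = ⊥-elim (¬r r)
  step         (no _)  (yes _) (yes _) a≤ = ℕₚ.m≤n⇒m≤1+n (+1ʳ a≤)
  step         (no _)  (yes _) (no _)  a≤ = ℕₚ.m≤n⇒m≤1+n a≤
  step         (no _)  (no _)  (yes _) a≤ = +1ʳ a≤
  step         (no _)  (no _)  (no _)  a≤ = a≤

count-─ : ∀ {n} {P : Pred (Fin n) 0ℓ} (P? : Decidable P) {a : Fin n} → P a → suc (count (P? ─ a)) ≤ℕ count P?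
count-─ {suc n} {P} P? {zero} pa =
  step (P? zero) ((P? ─ zero) zero)
       (count-mono (λ x → (P? ─ zero) (suc x)) (λ x → P? (suc x)) (λ x → proj₁))
  where
  step : ∀ {c d} (p : Dec (P zero)) (p─ : Dec (P zero × zero ≢ zero)) → c ≤ℕ d →
         suc (countStep p─ c) ≤ℕ countStep p d
  step _       (yes (_ , 0≢0)) c≤d = ⊥-elim (0≢0 refl)
  step (yes _) (no _)          c≤d = s≤s c≤d
  step (no ¬p) (no _)          c≤d = ⊥-elim (¬p pa)
count-─ {suc n} {P} P? {suc a} pa =
  step (P? zero) ((P? ─ suc a) zero) (ℕₚ.≤-trans (ℕₚ.≤-reflexive (cong suc shift)) (count-─ (λ x → P? (suc x)) pa))
  where
  shift : count (λ x → (P? ─ suc a) (suc x)) ≡ count ((λ x → P? (suc x)) ─ a)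
  shift = count-cong (λ x → (P? ─ suc a) (suc x)) ((λ x → P? (suc x)) ─ a) (λ x (p , x≢a) → p , λ eq → x≢a (cong suc eq))
                         (λ x (p , x≢a) → p , λ eq → x≢a (suc-injective eq))
  step : ∀ {c d} (p : Dec (P zero)) (p─ : Dec (P zero × zero ≢ suc a)) → suc c ≤ℕ d →
         suc (countStep p─ c) ≤ℕ countStep p d
  step (yes _) (yes _)       c<d = s≤s c<d
  step (yes _) (no _)        c<d = ℕₚ.m≤n⇒m≤1+n c<d
  step (no ¬p) (yes (p , _)) c<d = ⊥-elim (¬p p)
  step (no _)  (no _)        c<d = c<d

count-≥1 : ∀ {n} {P : Pred (Fin n) 0ℓ} (P? : Decidable P) {a : Fin n} → P a → 1 ≤ℕ count P?
count-≥1 P? pa = ℕₚ.≤-trans (s≤s z≤n) (count-─ P? pa)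

count-≥2 : ∀ {n} {P : Pred (Fin n) 0ℓ} (P? : Decidable P) {a b : Fin n} → P a → P b → a ≢ b → 2 ≤ℕ count P?
count-≥2 P? {a} pa pb a≢b = ℕₚ.≤-trans (s≤s (count-≥1 (P? ─ a) (pb , λ b≡a → a≢b (sym b≡a)))) (count-─ P? pa)

count-singleton : ∀ {n} (a : Fin n) → count (_≟ a) ≤ℕ 1
count-singleton {suc n} zero    = s≤s (ℕₚ.≤-reflexive (count-none {n} (λ x → suc x ≟ zero) (λ x ())))
  where
  count-none : ∀ {m} {P : Pred (Fin m) 0ℓ} (P? : Decidable P) → (∀ x → ¬ P x) → count P? ≡ 0
  count-none {zero}  P? none = refl
  count-none {suc m} P? none with P? zero
  ... | yes p = ⊥-elim (none zero p)
  ... | no _  = count-none _ (λ x → none (suc x))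
count-singleton {suc n} (suc a) with zero ≟ suc a   -- necessarily  no
... | no _ = ℕₚ.≤-trans (ℕₚ.≤-reflexive (count-cong (λ x → suc x ≟ suc a) (_≟ a)
                                                     (λ x → suc-injective) (λ x → cong suc)))
                        (count-singleton a)

count-exchange : ∀ {n} {P Q S : Pred (Fin n) 0ℓ} (P? : Decidable P) (Q? : Decidable Q) (S? : Decidable S)
                 {e : Fin n} → Q e → (∀ x → P x → (Q x × x ≢ e) ⊎ S x) →
                 suc (count P?) ≤ℕ count Q? + count S?
count-exchange P? Q? S? {e} qe cover = begin
  suc (count P?)                    ≤⟨ s≤s (count-∪ P? (Q? ─ e) S? cover) ⟩
  suc (count (Q? ─ e)) + count S?   ≤⟨ ℕₚ.+-monoˡ-≤ (count S?) (count-─ Q? qe) ⟩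
  count Q? + count S?               ∎
  where open ℕₚ.≤-Reasoning

module Orbits {n : ℕ} (σ : Perm n) where

  iter-suc : ∀ m x → iter σ (suc m) x ≡ iter σ m (σ ⟨$⟩ʳ x)
  iter-suc zero    x = refl
  iter-suc (suc m) x = cong (σ ⟨$⟩ʳ_) (iter-suc m x)

  iter-+ : ∀ a b x → iter σ (a + b) x ≡ iter σ a (iter σ b x)
  iter-+ zero    b x = refl
  iter-+ (suc a) b x = cong (σ ⟨$⟩ʳ_) (iter-+ a b x)

  iter-injective : ∀ m {y z} → iter σ m y ≡ iter σ m z → y ≡ z
  iter-injective zero    eq = eq
  iter-injective (suc m) {y} {z} eq = iter-injective m (begin
    iter σ m y                   ≡⟨ sym (inverseˡ σ) ⟩
    σ ⟨$⟩ˡ (σ ⟨$⟩ʳ iter σ m y)   ≡⟨ cong (σ ⟨$⟩ˡ_) eq ⟩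
    σ ⟨$⟩ˡ (σ ⟨$⟩ʳ iter σ m z)   ≡⟨ inverseˡ σ ⟩
    iter σ m z                   ∎)
    where open ≡-Reasoning

  -- by pigeonhole among x, σ x, …, σⁿ x, some power 1 ≤ p ≤ n fixes x
  period : ∀ x → ∃ λ p → 1 ≤ℕ p × p ≤ℕ n × iter σ p x ≡ x
  period x with pigeonhole (ℕₚ.n<1+n n) (λ (m : Fin (suc n)) → iter σ (toℕ m) x)
  ... | a , b , a<b , σᵃx≡σᵇx =
    p , ℕₚ.m<n⇒0<n∸m a<b , ℕₚ.≤-trans (ℕₚ.m∸n≤m (toℕ b) (toℕ a)) (ℕₚ.≤-pred (toℕ<n b)) ,
    iter-injective (toℕ a) (begin
      iter σ (toℕ a) (iter σ p x)  ≡⟨ sym (iter-+ (toℕ a) p x) ⟩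
      iter σ (toℕ a + p) x         ≡⟨ cong (λ q → iter σ q x) (ℕₚ.m+[n∸m]≡n (ℕₚ.<⇒≤ a<b)) ⟩
      iter σ (toℕ b) x             ≡⟨ sym σᵃx≡σᵇx ⟩
      iter σ (toℕ a) x             ∎)
    where
    p : ℕ
    p = toℕ b ∸ toℕ a
    open ≡-Reasoning

  below-period : ∀ {p x} → 1 ≤ℕ p → iter σ p x ≡ x → ∀ m → ∃ λ r → r <ℕ p × iter σ m x ≡ iter σ r x
  below-period 1≤p σᵖx≡x zero = zero , 1≤p , refl
  below-period {p} {x} 1≤p σᵖx≡x (suc m) with below-period 1≤p σᵖx≡x m
  ... | r , r<p , eq with suc r ℕ.≟ p
  ...   | yes r+1≡p = zero , 1≤p , trans (cong (σ ⟨$⟩ʳ_) eq) (trans (cong (λ q → iter σ q x) r+1≡p) σᵖx≡x)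
  ...   | no r+1≢p  = suc r , ℕₚ.≤∧≢⇒< r<p r+1≢p , cong (σ ⟨$⟩ʳ_) eq

  inCycle-bounded : ∀ {x y} → InCycle σ x y → ∃ λ (m : Fin n) → iter σ (toℕ m) x ≡ y
  inCycle-bounded {x} (m , σᵐx≡y) with period x
  ... | p , 1≤p , p≤n , σᵖx≡x with below-period 1≤p σᵖx≡x m
  ... | r , r<p , eq =
    fromℕ< r<n , trans (cong (λ q → iter σ q x) (toℕ-fromℕ< r<n)) (trans (sym eq) σᵐx≡y)
    where
    r<n : r <ℕ n
    r<n = ℕₚ.≤-trans r<p p≤n

  inCycle-trans : ∀ {x y z} → InCycle σ x y → InCycle σ y z → InCycle σ x z
  inCycle-trans {x} (a , refl) (b , refl) = b + a , iter-+ b a x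

  inCycle-sym : ∀ {x y} → InCycle σ x y → InCycle σ y x
  inCycle-sym {x} (m , σᵐx≡y) with period x
  ... | p , 1≤p , _ , σᵖx≡x with below-period 1≤p σᵖx≡x m
  ... | r , r<p , eq = p ∸ r , (begin
    iter σ (p ∸ r) _             ≡⟨ cong (iter σ (p ∸ r)) (trans (sym σᵐx≡y) eq) ⟩
    iter σ (p ∸ r) (iter σ r x)  ≡⟨ sym (iter-+ (p ∸ r) r x) ⟩
    iter σ (p ∸ r + r) x         ≡⟨ cong (λ q → iter σ q x) (ℕₚ.m∸n+n≡m (ℕₚ.<⇒≤ r<p)) ⟩
    iter σ p x                   ≡⟨ σᵖx≡x ⟩
    x                            ∎)
    where open ≡-Reasoning

  inCycle? : ∀ x y → Dec (InCycle σ x y)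
  inCycle? x y with any? (λ (m : Fin n) → iter σ (toℕ m) x ≟ y)
  ... | yes (m , eq) = yes (toℕ m , eq)
  ... | no ¬bounded  = no (λ c → ¬bounded (inCycle-bounded c))

  cycleMin-≤ : ∀ {x y} → CycleMin σ x → InCycle σ x y → x ≤ y
  cycleMin-≤ {x} isMin c with inCycle-bounded c
  ... | m , eq = subst (x ≤_) eq (isMin m)

  cycleMin-unique : ∀ {x y} → CycleMin σ x → CycleMin σ y → InCycle σ x y → x ≡ y
  cycleMin-unique xMin yMin c = Finₚ.≤-antisym (cycleMin-≤ xMin c) (cycleMin-≤ yMin (inCycle-sym c))

  -- every cycle has a minimum: the smallest of x, σ x, …, σⁿ⁻¹ x
  cycleMin-exists : ∀ x → ∃ λ e → InCycle σ x e × CycleMin σ e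
  cycleMin-exists x = e , (toℕ a , refl) , e-minimal
    where
    orbit : Fin n → Fin n
    orbit m = iter σ (toℕ m) x
    open import Data.List.Extrema (Finₚ.≤-totalOrder n) using (argmin; f[argmin]≤f[xs])
    a : Fin n
    a = argmin orbit x (allFin n)
    e : Fin n
    e = orbit a
    e-minimal : CycleMin σ e
    e-minimal m with inCycle-bounded (toℕ m + toℕ a , refl)
    ... | b , σᵇx≡σᵐe = subst (e ≤_) (trans σᵇx≡σᵐe (iter-+ (toℕ m) (toℕ a) x))
                          (All.lookup (f[argmin]≤f[xs] x (allFin n)) (∈-allFin b))

cycleMin? : ∀ {n} (σ : Perm n) → Decidable (CycleMin σ)
cycleMin? {n} σ x = all? {n = n} (λ m → x ≤? iter σ (toℕ m) x)

numCycles≡count : ∀ {n} (σ : Perm n) → numCycles σ ≡ count (cycleMin? σ)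
numCycles≡count {n} σ = length-filter-tabulate (cycleMin? σ) (λ x → x)
  where
  length-filter-tabulate : ∀ {m} {A : Set} {P : Pred A 0ℓ} (P? : Decidable P) (f : Fin m → A) →
                           length (filter P? (tabulate f)) ≡ count (λ x → P? (f x))
  length-filter-tabulate {zero}  P? f = refl
  length-filter-tabulate {suc m} P? f with P? (f zero)
  ... | yes _ = cong suc (length-filter-tabulate P? (λ x → f (suc x)))
  ... | no _  = length-filter-tabulate P? (λ x → f (suc x))

-- σ and σ⁻¹ have the same cycles, hence the same number of cycles
numCycles-flip : ∀ {n} (σ : Perm n) → numCycles (flip σ) ≡ numCycles σ
numCycles-flip σ = begin
  numCycles (flip σ)        ≡⟨ numCycles≡count (flip σ) ⟩
  count (cycleMin? (flip σ)) ≡⟨ count-cong (cycleMin? (flip σ)) (cycleMin? σ)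
                                  (λ x isMin m → Orbits.cycleMin-≤ (flip σ) isMin (inCycle-flip σ (toℕ m , refl)))
                                  (λ x isMin m → Orbits.cycleMin-≤ σ isMin (inCycle-flip (flip σ) (toℕ m , refl))) ⟩
  count (cycleMin? σ)        ≡⟨ sym (numCycles≡count σ) ⟩
  numCycles σ                ∎
  where
  open ≡-Reasoning
  iter-flip : ∀ {n} (π : Perm n) m y → iter (flip π) m (iter π m y) ≡ y
  iter-flip π zero    y = refl
  iter-flip π (suc m) y = trans (Orbits.iter-suc (flip π) m _)
                                (trans (cong (iter (flip π) m) (inverseˡ π)) (iter-flip π m y))
  inCycle-flip : ∀ {n} (π : Perm n) {x y} → InCycle π x y → InCycle (flip π) x y
  inCycle-flip π c with Orbits.inCycle-sym π c
  ... | m , refl = m , iter-flip π m _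

-- the long cycle c = (1 2 ⋯ n) has a single cycle; this is read off from
-- c⁻¹ : n ↦ n-1 ↦ ⋯ ↦ 1 ↦ n, whose only cycle minimum is 1
numCycles-longCycle : ∀ n → numCycles (longCycle (suc n)) ≡ 1
numCycles-longCycle n = begin
  numCycles c               ≡⟨ sym (numCycles-flip c) ⟩
  numCycles (flip c)        ≡⟨ numCycles≡count (flip c) ⟩
  count (cycleMin? (flip c)) ≡⟨ ℕₚ.≤-antisym
                                  (ℕₚ.≤-trans (ℕₚ.≤-reflexive (count-cong (cycleMin? (flip c)) (_≟ zero) only-0 (λ { x refl m → z≤n })))
                                              (count-singleton {suc n} zero))
                                  (count-≥1 (cycleMin? (flip c)) {zero} (λ m → z≤n)) ⟩
  1                          ∎
  where
  open ≡-Reasoning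
  c : Perm (suc n)
  c = longCycle (suc n)
  -- a nonzero point y+1 is not minimal: the next point y+1 ↦ y of its cycle is smaller
  only-0 : ∀ x → CycleMin (flip c) x → x ≡ zero
  only-0 zero              isMin = refl
  only-0 (suc {zero} ())   isMin
  only-0 (suc {suc _} y)   isMin =
    ⊥-elim (ℕₚ.<-irrefl refl (ℕₚ.≤-trans (isMin (suc zero)) (ℕₚ.≤-reflexive (toℕ-inject₁ y))))

transpose-left : ∀ {n} (i j : Fin n) → PC.transpose i j i ≡ j
transpose-left i j with i ≟ i
... | yes _  = refl
... | no i≢i = ⊥-elim (i≢i refl)

transpose-right : ∀ {n} (i j : Fin n) → PC.transpose i j j ≡ i
transpose-right i j with j ≟ i
... | yes j≡i = j≡i
... | no _ with j ≟ j
...   | yes _  = refl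
...   | no j≢j = ⊥-elim (j≢j refl)

transpose-other : ∀ {n} (i j x : Fin n) → x ≢ i → x ≢ j → PC.transpose i j x ≡ x
transpose-other i j x x≢i x≢j with x ≟ i
... | yes x≡i = ⊥-elim (x≢i x≡i)
... | no _ with x ≟ j
...   | yes x≡j = ⊥-elim (x≢j x≡j)
...   | no _    = refl

data Position {n : ℕ} (i j x : Fin n) : Set where
  at-i  : x ≡ i → Position i j x
  at-j  : x ≡ j → Position i j x
  other : x ≢ i → x ≢ j → Position i j x

position : ∀ {n} (i j x : Fin n) → Position i j x
position i j x with x ≟ i | x ≟ j
... | yes x≡i | _       = at-i x≡i
... | no _    | yes x≡j = at-j x≡j
... | no x≢i  | no x≢j  = other x≢i x≢j

-- Let σ = π · (i j).  Away from the cycles through i and j,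
-- σ and π have the same cycles; hence σ has at most one cycle more than π,
-- and no more cycles than π when i and j lie in different cycles of π
-- (multiplying by (i j) then merges the two cycles).

module Surgery {n : ℕ} (σ π : Perm n) (i j : Fin n)
               (σ≡π·τ : ∀ x → σ ⟨$⟩ʳ x ≡ π ⟨$⟩ʳ PC.transpose i j x) where

  open Orbits

  Hits : Fin n → Set
  Hits z = z ≡ i ⊎ z ≡ j

  first-visit : ∀ m x → Hits (iter π m x) → ∃ λ r → iter σ r x ≡ iter π r x × Hits (iter π r x)
  first-visit zero    x hit = zero , refl , hit
  first-visit (suc m) x hit with position i j x
  ... | at-i x≡i = zero , refl , inj₁ x≡i
  ... | at-j x≡j = zero , refl , inj₂ x≡j
  ... | other x≢i x≢j with first-visit m (π ⟨$⟩ʳ x) (subst Hits (iter-suc π m x) hit)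
  ...   | r , σʳ≡πʳ , hitʳ = suc r , agree-suc , subst Hits (sym (iter-suc π r x)) hitʳ
    where
    agree-suc : iter σ (suc r) x ≡ iter π (suc r) x
    agree-suc = begin
      iter σ (suc r) x         ≡⟨ iter-suc σ r x ⟩
      iter σ r (σ ⟨$⟩ʳ x)      ≡⟨ cong (iter σ r) (trans (σ≡π·τ x) (cong (π ⟨$⟩ʳ_) (transpose-other i j x x≢i x≢j))) ⟩
      iter σ r (π ⟨$⟩ʳ x)      ≡⟨ σʳ≡πʳ ⟩
      iter π r (π ⟨$⟩ʳ x)      ≡⟨ sym (iter-suc π r x) ⟩
      iter π (suc r) x         ∎
      where open ≡-Reasoning

  meets : ∀ x → InCycle π x i ⊎ InCycle π x j → InCycle σ x i ⊎ InCycle σ x j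
  meets x c with first-visit (proj₁ (hit c)) x (proj₂ (hit c))
    where
    hit : InCycle π x i ⊎ InCycle π x j → ∃ λ m → Hits (iter π m x)
    hit (inj₁ (m , eq)) = m , inj₁ eq
    hit (inj₂ (m , eq)) = m , inj₂ eq
  ... | r , σʳ≡πʳ , inj₁ πʳ≡i = inj₁ (r , trans σʳ≡πʳ πʳ≡i)
  ... | r , σʳ≡πʳ , inj₂ πʳ≡j = inj₂ (r , trans σʳ≡πʳ πʳ≡j)

  avoids : ∀ x → ¬ InCycle π x i → ¬ InCycle π x j → ∀ m → iter σ m x ≡ iter π m x
  avoids x ∉i ∉j zero    = refl
  avoids x ∉i ∉j (suc m) = trans (cong (σ ⟨$⟩ʳ_) (avoids x ∉i ∉j m))
    (trans (σ≡π·τ _) (cong (π ⟨$⟩ʳ_) (transpose-other i j _ (λ eq → ∉i (m , eq)) (λ eq → ∉j (m , eq)))))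

  eᵢ : Fin n
  eᵢ = proj₁ (cycleMin-exists π i)

  cycleMin-σ : ∀ x → CycleMin σ x → (CycleMin π x × x ≢ eᵢ) ⊎ (InCycle σ x i ⊎ InCycle σ x j)
  cycleMin-σ x isMin with inCycle? σ x i | inCycle? σ x j
  ... | yes c | _     = inj₂ (inj₁ c)
  ... | no _  | yes c = inj₂ (inj₂ c)
  ... | no σ∌i | no σ∌j = inj₁ (isMinπ , x≢eᵢ)
    where
    π∌ : InCycle π x i ⊎ InCycle π x j → ⊥
    π∌ c with meets x c
    ... | inj₁ ci = σ∌i ci
    ... | inj₂ cj = σ∌j cj
    π∌i : ¬ InCycle π x i
    π∌i c = π∌ (inj₁ c)
    isMinπ : CycleMin π x
    isMinπ m = subst (x ≤_) (avoids x π∌i (λ c → π∌ (inj₂ c)) (toℕ m)) (isMin m)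
    x≢eᵢ : x ≢ eᵢ
    x≢eᵢ refl = π∌i (inCycle-sym π (proj₁ (proj₂ (cycleMin-exists π i))))

  minσ : Fin n → Fin n
  minσ z = proj₁ (cycleMin-exists σ z)

  is-minσ : ∀ {x} z → CycleMin σ x → InCycle σ x z → x ≡ minσ z
  is-minσ z isMin c = cycleMin-unique σ isMin (proj₂ (proj₂ (cycleMin-exists σ z)))
                                      (inCycle-trans σ c (proj₁ (proj₂ (cycleMin-exists σ z))))

  eᵢ-isMin : CycleMin π eᵢ
  eᵢ-isMin = proj₂ (proj₂ (cycleMin-exists π i))

  -- the minima of σ: those of π except eᵢ, plus the minima of the cycles of i and j
  numCycles-≤suc : numCycles σ ≤ℕ suc (numCycles π)
  numCycles-≤suc = ℕₚ.≤-pred (begin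
    suc (numCycles σ)                  ≡⟨ cong suc (numCycles≡count σ) ⟩
    suc (count (cycleMin? σ))          ≤⟨ count-exchange (cycleMin? σ) (cycleMin? π) minima? eᵢ-isMin classify ⟩
    count (cycleMin? π) + count minima? ≤⟨ ℕₚ.+-monoʳ-≤ (count (cycleMin? π)) two-minima ⟩
    count (cycleMin? π) + 2            ≡⟨ ℕₚ.+-comm (count (cycleMin? π)) 2 ⟩
    suc (suc (count (cycleMin? π)))    ≡⟨ cong (λ c → suc (suc c)) (sym (numCycles≡count π)) ⟩
    suc (suc (numCycles π))            ∎)
    where
    open ℕₚ.≤-Reasoning
    minima? : Decidable (λ x → x ≡ minσ i ⊎ x ≡ minσ j)
    minima? x = (x ≟ minσ i) ⊎-dec (x ≟ minσ j)
    two-minima : count minima? ≤ℕ 2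
    two-minima = ℕₚ.≤-trans (count-∪ minima? (_≟ minσ i) (_≟ minσ j) (λ x p → p))
                            (ℕₚ.+-mono-≤ (count-singleton (minσ i)) (count-singleton (minσ j)))
    classify : ∀ x → CycleMin σ x → (CycleMin π x × x ≢ eᵢ) ⊎ (x ≡ minσ i ⊎ x ≡ minσ j)
    classify x isMin with cycleMin-σ x isMin
    ... | inj₁ old       = inj₁ old
    ... | inj₂ (inj₁ ci) = inj₂ (inj₁ (is-minσ i isMin ci))
    ... | inj₂ (inj₂ cj) = inj₂ (inj₂ (is-minσ j isMin cj))

  merged : ¬ InCycle π i j → InCycle σ i j
  merged π∌j with period π j
  ... | zero   , () , _ , _
  ... | suc p , _  , _ , πᵖj≡j with first-visit p (π ⟨$⟩ʳ j) (inj₂ (trans (sym (iter-suc π p j)) πᵖj≡j))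
  ...   | r , σʳ≡πʳ , inj₁ πʳ≡i = ⊥-elim (π∌j (inCycle-sym π (suc r , trans (iter-suc π r j) πʳ≡i)))
  ...   | r , σʳ≡πʳ , inj₂ πʳ≡j = suc r , (begin
    iter σ (suc r) i        ≡⟨ iter-suc σ r i ⟩
    iter σ r (σ ⟨$⟩ʳ i)     ≡⟨ cong (iter σ r) (trans (σ≡π·τ i) (cong (π ⟨$⟩ʳ_) (transpose-left i j))) ⟩
    iter σ r (π ⟨$⟩ʳ j)     ≡⟨ σʳ≡πʳ ⟩
    iter π r (π ⟨$⟩ʳ j)     ≡⟨ πʳ≡j ⟩
    j                       ∎)
    where open ≡-Reasoning

  -- after a merge only the minimum of the cycle of i can be new
  numCycles-merge : ¬ InCycle π i j → numCycles σ ≤ℕ numCycles π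
  numCycles-merge π∌j = ℕₚ.≤-pred (begin
    suc (numCycles σ)                        ≡⟨ cong suc (numCycles≡count σ) ⟩
    suc (count (cycleMin? σ))                ≤⟨ count-exchange (cycleMin? σ) (cycleMin? π) (_≟ minσ i) eᵢ-isMin classify ⟩
    count (cycleMin? π) + count (_≟ minσ i)  ≤⟨ ℕₚ.+-monoʳ-≤ (count (cycleMin? π)) (count-singleton (minσ i)) ⟩
    count (cycleMin? π) + 1                  ≡⟨ ℕₚ.+-comm (count (cycleMin? π)) 1 ⟩
    suc (count (cycleMin? π))                ≡⟨ cong suc (sym (numCycles≡count π)) ⟩
    suc (numCycles π)                        ∎)
    where
    open ℕₚ.≤-Reasoning
    classify : ∀ x → CycleMin σ x → (CycleMin π x × x ≢ eᵢ) ⊎ x ≡ minσ i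
    classify x isMin with cycleMin-σ x isMin
    ... | inj₁ old       = inj₁ old
    ... | inj₂ (inj₁ ci) = inj₂ (is-minσ i isMin ci)
    ... | inj₂ (inj₂ cj) = inj₂ (is-minσ i isMin (inCycle-trans σ cj (inCycle-sym σ (merged π∌j))))

-- The transposition (a b), a < b, is drawn as the arc (a , b); it
-- covers the half-open interval [a , b).  A list of arcs cuts Fin n into
-- blocks: x and y are unseparated when no arc covers exactly one of them.

Arc : ℕ → Set
Arc n = Fin n × Fin n

Covers : ∀ {n} → Arc n → Fin n → Set
Covers (a , b) x = toℕ a ≤ℕ toℕ x × toℕ x <ℕ toℕ b

covers? : ∀ {n} (t : Arc n) → Decidable (Covers t)
covers? (a , b) x = (toℕ a ℕ.≤? toℕ x) ×-dec (toℕ x ℕ.<? toℕ b)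

SameSide : ∀ {n} → Arc n → Fin n → Fin n → Set
SameSide t x y = (Covers t x → Covers t y) × (Covers t y → Covers t x)

sameSide? : ∀ {n} (t : Arc n) x y → Dec (SameSide t x y)
sameSide? t x y = (covers? t x →-dec covers? t y) ×-dec (covers? t y →-dec covers? t x)

Unseparated : ∀ {n} → List (Arc n) → Fin n → Fin n → Set
Unseparated ts x y = All (λ t → SameSide t x y) ts

module _ {n : ℕ} {ts : List (Arc n)} where

  unsep-refl : ∀ x → Unseparated ts x x
  unsep-refl x = All.universal (λ t → (λ c → c) , (λ c → c)) ts

  unsep-sym : ∀ {x y} → Unseparated ts x y → Unseparated ts y x
  unsep-sym = All.map (λ (to , from) → from , to)

  unsep-trans : ∀ {x y z} → Unseparated ts x y → Unseparated ts y z → Unseparated ts x z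
  unsep-trans x~y y~z = All.zipWith (λ ((to , from) , (to′ , from′)) → (λ c → to′ (to c)) , (λ c → from (from′ c)))
                                     (x~y , y~z)

unseparated? : ∀ {n} (ts : List (Arc n)) x y → Dec (Unseparated ts x y)
unseparated? ts x y = All.all? (λ t → sameSide? t x y) ts

-- Blocks do not cross: if i < x < j with i, j in one block and x outside it,
-- then the whole block of x lies strictly between i and j.

nested-arc : ∀ {n} (t : Arc n) {i j x y : Fin n} → i < x → x < j →
             SameSide t i j → ¬ SameSide t x i → SameSide t x y → i < y × y < j
nested-arc t@(a , b) {i} {j} {x} {y} i<x x<j (i→j , j→i) x≁i (x→y , _)
  with covers? t i | covers? t x
... | yes (a≤i , i<b) | _ =
  ⊥-elim (x≁i ((λ _ → a≤i , i<b) , (λ _ → ℕₚ.≤-trans a≤i (ℕₚ.<⇒≤ i<x) , ℕₚ.<-trans x<j j<b)))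
  where
  j<b : toℕ j <ℕ toℕ b
  j<b = proj₂ (i→j (a≤i , i<b))
... | no i∉t | no x∉t = ⊥-elim (x≁i ((λ c → ⊥-elim (x∉t c)) , (λ c → ⊥-elim (i∉t c))))
... | no i∉t | yes x∈t@(a≤x , x<b) = ℕₚ.<-≤-trans i<a (proj₁ (x→y x∈t)) , ℕₚ.<-≤-trans (proj₂ (x→y x∈t)) b≤j
  where
  i<a : toℕ i <ℕ toℕ a
  i<a with toℕ a ℕ.≤? toℕ i
  ... | yes a≤i = ⊥-elim (i∉t (a≤i , ℕₚ.<-trans i<x x<b))
  ... | no a≰i  = ℕₚ.≰⇒> a≰i
  b≤j : toℕ b ≤ℕ toℕ j
  b≤j with toℕ j ℕ.<? toℕ b
  ... | yes j<b = ⊥-elim (i∉t (j→i (ℕₚ.≤-trans a≤x (ℕₚ.<⇒≤ x<j) , j<b)))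
  ... | no j≮b  = ℕₚ.≮⇒≥ j≮b

nested : ∀ {n} (ts : List (Arc n)) {i j x y : Fin n} → i < x → x < j →
         Unseparated ts i j → ¬ Unseparated ts x i → Unseparated ts x y → i < y × y < j
nested []       i<x x<j i~j x≁i x~y = ⊥-elim (x≁i [])
nested (t ∷ ts) {i} {x = x} i<x x<j (i~j ∷ i~ⱼs) x≁i (x~y ∷ x~ys) with sameSide? t x i
... | no x≁ᵗi  = nested-arc t i<x x<j i~j x≁ᵗi x~y
... | yes x~ᵗi = nested ts i<x x<j i~ⱼs (λ x~i → x≁i (x~ᵗi ∷ x~i)) x~ys

-- Kreweras-type invariant.  f rotates the blocks cut out by ts downwards:
-- inside each block it maps every point to the next smaller point of the
-- block and the smallest point to the largest one.  (With no arcs there is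
-- one block and the rotation is c⁻¹ for the long cycle c.)

record Rotates {n : ℕ} (ts : List (Arc n)) (f : Fin n → Fin n) : Set where
  field
    stays   : ∀ x → Unseparated ts (f x) x
    -- a descent x ↦ f x skips no point of the block
    no-gap  : ∀ x y → f x < x → f x < y → y < x → ¬ Unseparated ts y x
    -- an ascent x ↦ f x starts at the minimum of the block …
    min-asc : ∀ x y → x ≤ f x → Unseparated ts y x → y < x → ⊥
    -- … and ends at its maximum
    max-asc : ∀ x y → x ≤ f x → Unseparated ts y x → f x < y → ⊥

rotates-down : ∀ {m} → Rotates {suc m} [] down
rotates-down {m} = record { stays = λ x → [] ; no-gap = no-gap ; min-asc = min-asc ; max-asc = max-asc }
  where
  no-gap : ∀ (x y : Fin (suc m)) → down x < x → down x < y → y < x → ¬ Unseparated [] y x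
  no-gap zero    y ()
  no-gap (suc x) y _ x<y y<x+1 _ rewrite toℕ-inject₁ x = ℕₚ.<⇒≱ x<y (ℕₚ.≤-pred y<x+1)
  min-asc : ∀ (x y : Fin (suc m)) → x ≤ down x → Unseparated [] y x → y < x → ⊥
  min-asc zero    y _   _ ()
  min-asc (suc x) y x<x _ _ rewrite toℕ-inject₁ x = ℕₚ.<-irrefl refl x<x
  max-asc : ∀ (x y : Fin (suc m)) → x ≤ down x → Unseparated [] y x → down x < y → ⊥
  max-asc zero    y _   _ m<y rewrite toℕ-fromℕ m = ℕₚ.<⇒≱ m<y (ℕₚ.≤-pred (toℕ<n y))
  max-asc (suc x) y x<x _ _ rewrite toℕ-inject₁ x = ℕₚ.<-irrefl refl x<x

<-or-≥ : ∀ a b → a <ℕ b ⊎ b ≤ℕ a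
<-or-≥ a b with a ℕ.<? b
... | yes a<b = inj₁ a<b
... | no a≮b  = inj₂ (ℕₚ.≮⇒≥ a≮b)

strict : ∀ {n} {x y : Fin n} → x ≤ y → y ≢ x → x < y
strict x≤y y≢x = ℕₚ.≤∧≢⇒< x≤y (λ eq → y≢x (Finₚ.toℕ-injective (sym eq)))

-- Adding an arc (i , j) inside one block splits the block in two, and
-- g = f ∘ (i j) rotates the refined blocks.

module RotationStep {n : ℕ} (ts : List (Arc n)) {i j : Fin n} (i<j : i < j) (i~j : Unseparated ts i j)
                    {f g : Fin n → Fin n} (g≡f∘τ : ∀ x → g x ≡ f (PC.transpose i j x))
                    (rot : Rotates ts f) where
  open Rotates rot

  t : Arc n
  t = (i , j)

  j~i : Unseparated ts j i
  j~i = unsep-sym i~j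

  g-i : g i ≡ f j
  g-i = trans (g≡f∘τ i) (cong f (transpose-left i j))

  g-j : g j ≡ f i
  g-j = trans (g≡f∘τ j) (cong f (transpose-right i j))

  g-other : ∀ {x} → x ≢ i → x ≢ j → g x ≡ f x
  g-other {x} x≢i x≢j = trans (g≡f∘τ x) (cong f (transpose-other i j x x≢i x≢j))

  -- j descends into [i , j): its block contains i < j
  fj∈t : Covers t (f j)
  fj∈t with <-or-≥ (toℕ (f j)) (toℕ j)
  ... | inj₂ j≤fj = ⊥-elim (min-asc j i j≤fj i~j i<j)
  ... | inj₁ fj<j with <-or-≥ (toℕ (f j)) (toℕ i)
  ...   | inj₁ fj<i = ⊥-elim (no-gap j i fj<j fj<i i<j i~j)
  ...   | inj₂ i≤fj = i≤fj , fj<j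

  -- i moves out of [i , j): otherwise it would ascend past the block member j
  fi∉t : f i < i ⊎ j ≤ f i
  fi∉t with <-or-≥ (toℕ (f i)) (toℕ i)
  ... | inj₁ fi<i = inj₁ fi<i
  ... | inj₂ i≤fi with <-or-≥ (toℕ (f i)) (toℕ j)
  ...   | inj₁ fi<j = ⊥-elim (max-asc i j i≤fi j~i fi<j)
  ...   | inj₂ j≤fi = inj₂ j≤fi

  ¬fi∈t : ¬ Covers t (f i)
  ¬fi∈t (i≤fi , fi<j) with fi∉t
  ... | inj₁ fi<i = ℕₚ.<⇒≱ fi<i i≤fi
  ... | inj₂ j≤fi = ℕₚ.<⇒≱ fi<j j≤fi

  sameSide-inside : ∀ x → x ≢ i → x ≢ j → Unseparated ts x i → SameSide t (f x) x
  sameSide-inside x x≢i x≢j x~i = to , from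
    where
    i~x : Unseparated ts i x
    i~x = unsep-sym x~i
    j~x : Unseparated ts j x
    j~x = unsep-trans j~i i~x
    to : Covers t (f x) → Covers t x
    to (i≤fx , fx<j) with <-or-≥ (toℕ x) (toℕ i)
    ... | inj₁ x<i with <-or-≥ (toℕ (f x)) (toℕ x)
    ...   | inj₁ fx<x = ⊥-elim (ℕₚ.<⇒≱ (ℕₚ.<-trans fx<x x<i) i≤fx)
    ...   | inj₂ x≤fx = ⊥-elim (max-asc x j x≤fx j~x fx<j)
    to (i≤fx , fx<j) | inj₂ i≤x with <-or-≥ (toℕ x) (toℕ j)
    ... | inj₁ x<j = i≤x , x<j
    ... | inj₂ j≤x with <-or-≥ (toℕ (f x)) (toℕ x)
    ...   | inj₁ fx<x = ⊥-elim (no-gap x j fx<x fx<j (strict j≤x x≢j) j~x)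
    ...   | inj₂ x≤fx = ⊥-elim (min-asc x j x≤fx j~x (strict j≤x x≢j))
    from : Covers t x → Covers t (f x)
    from (i≤x , x<j) with <-or-≥ (toℕ (f x)) (toℕ x)
    ... | inj₂ x≤fx = ⊥-elim (min-asc x i x≤fx i~x (strict i≤x x≢i))
    ... | inj₁ fx<x with <-or-≥ (toℕ (f x)) (toℕ i)
    ...   | inj₁ fx<i = ⊥-elim (no-gap x i fx<x fx<i (strict i≤x x≢i) i~x)
    ...   | inj₂ i≤fx = i≤fx , ℕₚ.<-trans fx<x x<j

  -- for x outside the block of i, that block lies on one side of the new arc,
  -- and f x belongs to the block of x
  sameSide-outside : ∀ x → ¬ Unseparated ts x i → SameSide t (f x) x
  sameSide-outside x x≁i = to , from
    where
    to : Covers t (f x) → Covers t x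
    to (i≤fx , fx<j) =
      let (i<x , x<j) = nested ts (strict i≤fx fx≢i) fx<j i~j fx≁i (stays x) in ℕₚ.<⇒≤ i<x , x<j
      where
      fx≁i : ¬ Unseparated ts (f x) i
      fx≁i fx~i = x≁i (unsep-trans (unsep-sym (stays x)) fx~i)
      fx≢i : f x ≢ i
      fx≢i eq = fx≁i (subst (λ z → Unseparated ts z i) (sym eq) (unsep-refl i))
    from : Covers t x → Covers t (f x)
    from (i≤x , x<j) =
      let (i<fx , fx<j) = nested ts (strict i≤x x≢i) x<j i~j x≁i (unsep-sym (stays x)) in ℕₚ.<⇒≤ i<fx , fx<j
      where
      x≢i : x ≢ i
      x≢i refl = x≁i (unsep-refl i)

  g-sameSide : ∀ x → SameSide t (g x) x
  g-sameSide x with position i j x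
  ... | at-i refl = (λ _ → ℕₚ.≤-refl , i<j) , (λ _ → subst (Covers t) (sym g-i) fj∈t)
  ... | at-j refl = (λ c → ⊥-elim (¬fi∈t (subst (Covers t) g-j c))) , (λ c → ⊥-elim (ℕₚ.<-irrefl refl (proj₂ c)))
  ... | other x≢i x≢j with unseparated? ts x i
  ...   | yes x~i = subst (λ z → SameSide t z x) (sym (g-other x≢i x≢j)) (sameSide-inside x x≢i x≢j x~i)
  ...   | no x≁i  = subst (λ z → SameSide t z x) (sym (g-other x≢i x≢j)) (sameSide-outside x x≁i)

  ts′ : List (Arc n)
  ts′ = ts ++ t ∷ []

  old : ∀ {x y} → Unseparated ts′ x y → Unseparated ts x y
  old = AllP.++⁻ˡ ts

  new : ∀ {x y} → Unseparated ts′ x y → SameSide t x y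
  new x~y with AllP.++⁻ʳ ts x~y
  ... | s ∷ [] = s

  τ-stays : ∀ x → Unseparated ts (PC.transpose i j x) x
  τ-stays x with position i j x
  ... | at-i refl = subst (λ z → Unseparated ts z x) (sym (transpose-left i j)) j~i
  ... | at-j refl = subst (λ z → Unseparated ts z x) (sym (transpose-right i j)) i~j
  ... | other x≢i x≢j = subst (λ z → Unseparated ts z x) (sym (transpose-other i j x x≢i x≢j)) (unsep-refl x)

  stays′ : ∀ x → Unseparated ts′ (g x) x
  stays′ x = AllP.++⁺ (subst (λ z → Unseparated ts z x) (sym (g≡f∘τ x)) (unsep-trans (stays _) (τ-stays x)))
                      (g-sameSide x ∷ [])

  no-gap′ : ∀ x y → g x < x → g x < y → y < x → ¬ Unseparated ts′ y x
  no-gap′ x y gx<x gx<y y<x y~x with position i j x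
  ... | at-i refl = ℕₚ.<⇒≱ (subst (_< x) g-i gx<x) (proj₁ fj∈t)
  ... | at-j refl with fi∉t
  ...   | inj₂ j≤fi = ℕₚ.<⇒≱ (subst (_< x) g-j gx<x) j≤fi
  ...   | inj₁ fi<i with <-or-≥ (toℕ y) (toℕ i)
  ...     | inj₁ y<i = no-gap i y fi<i (subst (_< y) g-j gx<y) y<i (unsep-trans (old y~x) j~i)
  ...     | inj₂ i≤y = ℕₚ.<-irrefl refl (proj₂ (proj₁ (new y~x) (i≤y , y<x)))
  no-gap′ x y gx<x gx<y y<x y~x | other x≢i x≢j =
    no-gap x y (subst (_< x) (g-other x≢i x≢j) gx<x) (subst (_< y) (g-other x≢i x≢j) gx<y) y<x (old y~x)

  min-asc′ : ∀ x y → x ≤ g x → Unseparated ts′ y x → y < x → ⊥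
  min-asc′ x y x≤gx y~x y<x with position i j x
  ... | at-i refl = ℕₚ.<⇒≱ y<x (proj₁ (proj₂ (new y~x) (ℕₚ.≤-refl , i<j)))
  ... | at-j refl with <-or-≥ (toℕ y) (toℕ i)
  ...   | inj₂ i≤y = ℕₚ.<-irrefl refl (proj₂ (proj₁ (new y~x) (i≤y , y<x)))
  ...   | inj₁ y<i with fi∉t
  ...     | inj₁ fi<i = ℕₚ.<⇒≱ (ℕₚ.<-trans fi<i i<j) (subst (x ≤_) g-j x≤gx)
  ...     | inj₂ j≤fi = min-asc i y (ℕₚ.≤-trans (ℕₚ.<⇒≤ i<j) j≤fi) (unsep-trans (old y~x) j~i) y<i
  min-asc′ x y x≤gx y~x y<x | other x≢i x≢j = min-asc x y (subst (x ≤_) (g-other x≢i x≢j) x≤gx) (old y~x) y<x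

  max-asc′ : ∀ x y → x ≤ g x → Unseparated ts′ y x → g x < y → ⊥
  max-asc′ x y x≤gx y~x gx<y with position i j x
  ... | at-i refl = no-gap j y (proj₂ fj∈t) (subst (_< y) g-i gx<y) y<j (unsep-trans (old y~x) i~j)
    where
    y<j : y < j
    y<j = proj₂ (proj₂ (new y~x) (ℕₚ.≤-refl , i<j))
  ... | at-j refl with fi∉t
  ...   | inj₁ fi<i = ℕₚ.<⇒≱ (ℕₚ.<-trans fi<i i<j) (subst (x ≤_) g-j x≤gx)
  ...   | inj₂ j≤fi = max-asc i y (ℕₚ.≤-trans (ℕₚ.<⇒≤ i<j) j≤fi) (unsep-trans (old y~x) j~i) (subst (_< y) g-j gx<y)
  max-asc′ x y x≤gx y~x gx<y | other x≢i x≢j =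
    max-asc x y (subst (x ≤_) (g-other x≢i x≢j) x≤gx) (old y~x) (subst (_< y) (g-other x≢i x≢j) gx<y)

  rotates′ : Rotates ts′ g
  rotates′ = record { stays = stays′ ; no-gap = no-gap′ ; min-asc = min-asc′ ; max-asc = max-asc′ }

Preserves : ∀ {n} → Perm n → Pred (Fin n) 0ℓ → Set
Preserves σ J = ∀ z → J z → J (σ ⟨$⟩ʳ z)

module _ {n : ℕ} where

  prodL-snoc : ∀ (ts : List (Arc n)) t x → prodL (ts ++ t ∷ []) ⟨$⟩ʳ x ≡ prodL ts ⟨$⟩ʳ (transp t ⟨$⟩ʳ x)
  prodL-snoc []       t x = refl
  prodL-snoc (s ∷ ts) t x = cong (transp s ⟨$⟩ʳ_) (prodL-snoc ts t x)

  prodL-fixes : ∀ (ts : List (Arc n)) x → All (λ t → x ≢ proj₁ t × x ≢ proj₂ t) ts → prodL ts ⟨$⟩ʳ x ≡ x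
  prodL-fixes []             x []                     = refl
  prodL-fixes ((p , q) ∷ ts) x ((x≢p , x≢q) ∷ untouched) =
    trans (cong (PC.transpose p q) (prodL-fixes ts x untouched)) (transpose-other p q x x≢p x≢q)

  prodL-preserves : ∀ (J : Pred (Fin n) 0ℓ) (ts : List (Arc n)) →
                    All (λ t → Preserves (transp t) J) ts → Preserves (prodL ts) J
  prodL-preserves J []       []              z Jz = Jz
  prodL-preserves J (t ∷ ts) (pres ∷ presAll) z Jz = pres _ (prodL-preserves J ts presAll z Jz)

  inCycle-preserves : ∀ {σ : Perm n} {J : Pred (Fin n) 0ℓ} → Preserves σ J → ∀ {x y} → InCycle σ x y → J x → J y
  inCycle-preserves {σ} {J} pres {x} (m , refl) Jx = go m
    where
    go : ∀ r → J (iter σ r x)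
    go zero    = Jx
    go (suc r) = pres _ (go r)

  inCycle-fixed : ∀ (σ : Perm n) {x y} → σ ⟨$⟩ʳ x ≡ x → InCycle σ x y → y ≡ x
  inCycle-fixed σ {x} σx≡x c = inCycle-preserves {J = _≡ x} (λ z z≡x → trans (cong (σ ⟨$⟩ʳ_) z≡x) σx≡x) c refl

  inCycle-unseparated : ∀ {ts : List (Arc n)} {σ : Perm n} → Rotates ts (σ ⟨$⟩ʳ_) →
                        ∀ {x y} → InCycle σ x y → Unseparated ts x y
  inCycle-unseparated {ts} {σ} rot {x} c =
    inCycle-preserves {J = Unseparated ts x} (λ z x~z → unsep-trans x~z (unsep-sym (Rotates.stays rot z))) c (unsep-refl x)

module _ {A : Set} where

  take-suc : ∀ {k} (γ : Vec A k) (s : Fin k) →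
             take (suc (toℕ s)) (toList γ) ≡ take (toℕ s) (toList γ) ++ lookup γ s ∷ []
  take-suc (a ∷ᵥ γ) zero    = refl
  take-suc (a ∷ᵥ γ) (suc s) = cong (a ∷_) (take-suc γ s)

  lookup∈take : ∀ {k} (γ : Vec A k) m (s : Fin k) → toℕ s <ℕ m → lookup γ s ∈ take m (toList γ)
  lookup∈take (a ∷ᵥ γ) (suc m) zero    s<m = here refl
  lookup∈take (a ∷ᵥ γ) (suc m) (suc s) s<m = there (lookup∈take γ m s (ℕₚ.≤-pred s<m))

  all-take : ∀ {k} {P : Pred A 0ℓ} (γ : Vec A k) m → (∀ s → toℕ s <ℕ m → P (lookup γ s)) → All P (take m (toList γ))
  all-take γ        zero    hyp = []
  all-take []ᵥ      (suc m) hyp = []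
  all-take (a ∷ᵥ γ) (suc m) hyp = hyp zero (s≤s z≤n) ∷ all-take γ m (λ s s<m → hyp (suc s) (s≤s s<m))

-- The Kreweras complement c⁻¹ · τ₁ ⋯ τ_m of a product of transpositions,
-- c = (1 2 ⋯ n).  It is written as the inverse of (τ₁ ⋯ τ_m)⁻¹ · c, the
-- permutation whose cycles are counted in  _≼_ .

kreweras : ∀ {n} → List (Arc n) → Perm n
kreweras {n} ts = flip (flip (prodL ts) · longCycle n)

kreweras-snoc : ∀ {n} (ts : List (Arc n)) t x →
                kreweras (ts ++ t ∷ []) ⟨$⟩ʳ x ≡ kreweras ts ⟨$⟩ʳ (transp t ⟨$⟩ʳ x)
kreweras-snoc {suc m} ts t x = cong down (prodL-snoc ts t x)

-- Let κ_l be the Kreweras complement of γ_l and b_l its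
-- number of cycles.  Then b_0 = 1, each step raises b by at most one, and the
-- defining equations of Σ_n(k) force b_k = k + 1; so every step raises b by
-- exactly one.  Hence every τ_l splits a cycle of κ_{l-1}, which makes the
-- arcs (i_s , j_s) non-crossing.

module MinimalFactorization {m k : ℕ} (γ : Vec (Arc (suc m)) k) (γ∈Σ : InΣ (suc m) k γ) where

  n : ℕ
  n = suc m

  i_ j_ : Fin k → Fin n
  i_ s = proj₁ (lookup γ s)
  j_ s = proj₂ (lookup γ s)

  i<j : ∀ s → i_ s < j_ s
  i<j = proj₁ γ∈Σ

  prefix : ℕ → List (Arc n)
  prefix l = take l (toList γ)

  κ : ℕ → Perm n
  κ l = kreweras (prefix l)

  b : ℕ → ℕ
  b l = numCycles (κ l)

  -- κ at step s + 1 is κ at step s times τ_s (0-based indices)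
  κ-step : ∀ (s : Fin k) x → κ (suc (toℕ s)) ⟨$⟩ʳ x ≡ κ (toℕ s) ⟨$⟩ʳ PC.transpose (i_ s) (j_ s) x
  κ-step s x = trans (cong (λ ts → kreweras ts ⟨$⟩ʳ x) (take-suc γ s)) (kreweras-snoc (prefix (toℕ s)) (lookup γ s) x)

  b-step : ∀ (s : Fin k) → b (suc (toℕ s)) ≤ℕ suc (b (toℕ s))
  b-step s = Surgery.numCycles-≤suc (κ (suc (toℕ s))) (κ (toℕ s)) (i_ s) (j_ s) (κ-step s)

  b-steps : ∀ l d → l + d ≤ℕ k → b (l + d) ≤ℕ b l + d
  b-steps l zero    _     rewrite ℕₚ.+-identityʳ l | ℕₚ.+-identityʳ (b l) = ℕₚ.≤-refl
  b-steps l (suc d) l+d<k rewrite ℕₚ.+-suc l d | ℕₚ.+-suc (b l) d =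
    ℕₚ.≤-trans (subst (λ e → b (suc e) ≤ℕ suc (b e)) (toℕ-fromℕ< l+d<k) (b-step (fromℕ< l+d<k)))
               (s≤s (b-steps l d (ℕₚ.<⇒≤ l+d<k)))

  b-0 : b 0 ≡ 1
  b-0 = trans (numCycles-flip (longCycle n)) (numCycles-longCycle m)

  -- from |γ_k| = k and |c| = |γ_k| + |γ_k⁻¹ c|, with |c| = n - 1
  b-k : b k ≡ suc k
  b-k = ℕₚ.+-cancelʳ-≡ m (b k) (suc k) (begin
    b k + m                    ≡⟨ cong (b k +_) m≡k+[n∸bk] ⟩
    b k + (k + (n ∸ b k))      ≡⟨ ℕₚ.+-comm (b k) (k + (n ∸ b k)) ⟩
    k + (n ∸ b k) + b k        ≡⟨ ℕₚ.+-assoc k (n ∸ b k) (b k) ⟩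
    k + (n ∸ b k + b k)        ≡⟨ cong (k +_) (ℕₚ.m∸n+n≡m bk≤n) ⟩
    k + n                      ≡⟨ ℕₚ.+-suc k m ⟩
    suc k + m                  ∎)
    where
    open ≡-Reasoning
    γk : Perm n
    γk = partialProd γ k
    bk≤n : b k ≤ℕ n
    bk≤n = subst (_≤ℕ n) (sym (numCycles≡count (κ k))) (count-≤ (cycleMin? (κ k)))
    m≡k+[n∸bk] : m ≡ k + (n ∸ b k)
    m≡k+[n∸bk] = begin
      m                                                 ≡⟨ cong (n ∸_) (sym (numCycles-longCycle m)) ⟩
      ∣ longCycle n ∣ₚ                                   ≡⟨ proj₂ (proj₂ γ∈Σ) ⟩
      ∣ γk ∣ₚ + (n ∸ numCycles (flip γk · longCycle n))  ≡⟨ cong₂ _+_ (proj₁ (proj₂ γ∈Σ))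
                                                              (cong (n ∸_) (sym (numCycles-flip (flip γk · longCycle n)))) ⟩
      k + (n ∸ b k)                                     ∎

  b-exact : ∀ l → l ≤ℕ k → b l ≡ suc l
  b-exact l l≤k = ℕₚ.≤-antisym upper lower
    where
    upper : b l ≤ℕ suc l
    upper = subst (λ c → b l ≤ℕ c + l) b-0 (b-steps 0 l l≤k)
    lower : suc l ≤ℕ b l
    lower = ℕₚ.+-cancelʳ-≤ (k ∸ l) (suc l) (b l) (begin
      suc l + (k ∸ l)   ≡⟨ cong suc (ℕₚ.m+[n∸m]≡n l≤k) ⟩
      suc k             ≡⟨ sym b-k ⟩
      b k               ≡⟨ cong b (sym (ℕₚ.m+[n∸m]≡n l≤k)) ⟩
      b (l + (k ∸ l))   ≤⟨ b-steps l (k ∸ l) (ℕₚ.≤-reflexive (ℕₚ.m+[n∸m]≡n l≤k)) ⟩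
      b l + (k ∸ l)     ∎)
      where open ℕₚ.≤-Reasoning

  splits : ∀ (s : Fin k) → InCycle (κ (toℕ s)) (i_ s) (j_ s)
  splits s with Orbits.inCycle? (κ (toℕ s)) (i_ s) (j_ s)
  ... | yes c      = c
  ... | no apart = ⊥-elim (ℕₚ.<-irrefl refl (begin-strict
    suc (suc (toℕ s))   ≡⟨ sym (b-exact (suc (toℕ s)) (toℕ<n s)) ⟩
    b (suc (toℕ s))     ≤⟨ Surgery.numCycles-merge (κ (suc (toℕ s))) (κ (toℕ s)) (i_ s) (j_ s) (κ-step s) apart ⟩
    b (toℕ s)           ≡⟨ b-exact (toℕ s) (ℕₚ.<⇒≤ (toℕ<n s)) ⟩
    suc (toℕ s)         <⟨ ℕₚ.n<1+n (suc (toℕ s)) ⟩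
    suc (suc (toℕ s))   ∎))
    where open ℕₚ.≤-Reasoning

  unseparated : ∀ (s : Fin k) → Rotates (prefix (toℕ s)) (κ (toℕ s) ⟨$⟩ʳ_) →
                Unseparated (prefix (toℕ s)) (i_ s) (j_ s)
  unseparated s rot = inCycle-unseparated rot (splits s)

  rotates : ∀ l → l ≤ℕ k → Rotates (prefix l) (κ l ⟨$⟩ʳ_)
  rotates zero    _   = rotates-down
  rotates (suc l) l<k with fromℕ< l<k | toℕ-fromℕ< l<k
  ... | s | refl = step s (rotates (toℕ s) (ℕₚ.<⇒≤ l<k))
    where
    step : ∀ (s : Fin k) → Rotates (prefix (toℕ s)) (κ (toℕ s) ⟨$⟩ʳ_) →
           Rotates (prefix (suc (toℕ s))) (κ (suc (toℕ s)) ⟨$⟩ʳ_)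
    step s rot = subst (λ ts → Rotates ts (κ (suc (toℕ s)) ⟨$⟩ʳ_)) (sym (take-suc γ s))
                       (RotationStep.rotates′ (prefix (toℕ s)) (i<j s) (unseparated s rot) (κ-step s) rot)

  noncrossing : ∀ (s t : Fin k) → toℕ s <ℕ toℕ t → SameSide (lookup γ s) (i_ t) (j_ t)
  noncrossing s t s<t = All.lookup (unseparated t (rotates (toℕ t) (ℕₚ.<⇒≤ (toℕ<n t))))
                                   (lookup∈take γ (toℕ t) s s<t)

  -- if k = n - 1 then γ_k has a single cycle, so it fixes no point x ≠ 1
  -- (1 and x would be two cycle minima)
  no-fixed-point : k ≡ m → ∀ x → x ≢ zero → partialProd γ k ⟨$⟩ʳ x ≢ x
  no-fixed-point k≡m x x≢0 γkx≡x = ℕₚ.<-irrefl k≡m (begin-strict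
    k                              ≡⟨ sym (proj₁ (proj₂ γ∈Σ)) ⟩
    n ∸ numCycles γk               ≤⟨ ℕₚ.∸-monoʳ-≤ n two-cycles ⟩
    n ∸ 2                          <⟨ ℕₚ.∸-monoʳ-< {n} {2} {1} ℕₚ.≤-refl (s≤s 1≤m) ⟩
    m                              ∎)
    where
    open ℕₚ.≤-Reasoning
    γk : Perm n
    γk = partialProd γ k
    1≤m : 1 ≤ℕ m
    1≤m = ℕₚ.≤-trans (ℕₚ.n≢0⇒n>0 (λ x≡0 → x≢0 (Finₚ.toℕ-injective x≡0))) (ℕₚ.≤-pred (toℕ<n x))
    two-cycles : 2 ≤ℕ numCycles γk
    two-cycles = subst (2 ≤ℕ_) (sym (numCycles≡count γk))
      (count-≥2 (cycleMin? γk) {zero} {x} (λ _ → z≤n)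
                (λ r → ℕₚ.≤-reflexive (cong toℕ (sym (inCycle-fixed γk γkx≡x (toℕ r , refl)))))
                (λ 0≡x → x≢0 (sym 0≡x)))

Interval : ∀ {n} → Fin n → Fin n → Pred (Fin n) 0ℓ
Interval i j z = i < z × z ≤ j

transpose-preserves : ∀ {n} {p q : Fin n} (J : Pred (Fin n) 0ℓ) → (J p → J q) → (J q → J p) →
                      Preserves (transp (p , q)) J
transpose-preserves {p = p} {q} J p→q q→p z Jz with position p q z
... | at-i refl        = subst J (sym (transpose-left p q)) (p→q Jz)
... | at-j refl        = subst J (sym (transpose-right p q)) (q→p Jz)
... | other z≢p z≢q    = subst J (sym (transpose-other p q z z≢p z≢q)) Jz

arc-preserves-interval : ∀ {n} {p q i j : Fin n} → p < q → SameSide (p , q) i j →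
                         Preserves (transp (p , q)) (Interval i j)
arc-preserves-interval {p = p} {q} {i} {j} p<q (i→j , j→i) = transpose-preserves (Interval i j) p∈J⇒q∈J q∈J⇒p∈J
  where
  p∈J⇒q∈J : Interval i j p → Interval i j q
  p∈J⇒q∈J (i<p , p≤j) with <-or-≥ (toℕ j) (toℕ q)
  ... | inj₁ j<q = ⊥-elim (ℕₚ.<⇒≱ i<p (proj₁ (j→i (p≤j , j<q))))
  ... | inj₂ q≤j = ℕₚ.<-trans i<p p<q , q≤j
  q∈J⇒p∈J : Interval i j q → Interval i j p
  q∈J⇒p∈J (i<q , q≤j) with <-or-≥ (toℕ i) (toℕ p)
  ... | inj₁ i<p = i<p , ℕₚ.≤-trans (ℕₚ.<⇒≤ p<q) q≤j
  ... | inj₂ p≤i = ⊥-elim (ℕₚ.<⇒≱ (proj₂ (i→j (p≤i , i<q))) q≤j)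

module Step {m k : ℕ} (γ : Vec (Arc (suc m)) k) (γ∈Σ : InΣ (suc m) k γ) (l : Fin k) where
  open MinimalFactorization γ γ∈Σ

  i j : Fin n
  i = i_ l
  j = j_ l

  σ : Perm n
  σ = partialProd γ (toℕ l)

  J : Pred (Fin n) 0ℓ
  J = Interval i j

  -- the arcs of σ do not cross (i_l , j_l), so σ maps (i_l , j_l] into itself
  σ-preserves : Preserves σ J
  σ-preserves = prodL-preserves J (prefix (toℕ l))
    (all-take γ (toℕ l) (λ s s<l → arc-preserves-interval (i<j s) (noncrossing s l s<l)))

  j∈J : J j
  j∈J = i<j l , ℕₚ.≤-refl

  IsNext : Fin n → Set
  IsNext x = toℕ x ≡ toℕ i + 1

  isNext-suc : ∀ {x} → IsNext x → toℕ x ≡ suc (toℕ i)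
  isNext-suc x≡i+1 = trans x≡i+1 (ℕₚ.+-comm (toℕ i) 1)

  next∈J : ∀ {x} → IsNext x → J x
  next∈J x≡i+1 = ℕₚ.≤-reflexive (sym (isNext-suc x≡i+1)) ,
                 subst (_≤ℕ toℕ j) (sym (isNext-suc x≡i+1)) (i<j l)

  cycle-i-outside : ∀ {y} → InCycle σ i y → ¬ J y
  cycle-i-outside c y∈J = ℕₚ.<-irrefl refl (proj₁ (inCycle-preserves σ-preserves (Orbits.inCycle-sym σ c) y∈J))

  -- an earlier transposition never has i_l + 1 as its larger point: it would
  -- map i_l + 1 ∈ (i_l , j_l] to its smaller point, which is ≤ i_l
  earlier-j≢next : ∀ (s : Fin k) → toℕ s <ℕ toℕ l → ∀ {x} → IsNext x → j_ s ≢ x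
  earlier-j≢next s s<l x≡i+1 refl = ℕₚ.<-irrefl refl (ℕₚ.<-≤-trans i<is (ℕₚ.≤-pred is<x))
    where
    is∈J : J (i_ s)
    is∈J = subst J (transpose-right (i_ s) (j_ s))
                 (arc-preserves-interval (i<j s) (noncrossing s l s<l) (j_ s) (next∈J x≡i+1))
    i<is : i < i_ s
    i<is = proj₁ is∈J
    is<x : toℕ (i_ s) <ℕ suc (toℕ i)
    is<x = subst (toℕ (i_ s) <ℕ_) (isNext-suc x≡i+1) (i<j s)

  next-fixed : ∀ {x} → IsNext x → (∀ (s : Fin k) → toℕ s <ℕ toℕ l → i_ s ≢ x) → σ ⟨$⟩ʳ x ≡ x
  next-fixed {x} x≡i+1 not-i = prodL-fixes (prefix (toℕ l)) x (all-take γ (toℕ l) (λ s s<l →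
    (λ x≡is → not-i s s<l (sym x≡is)) , (λ x≡js → earlier-j≢next s s<l x≡i+1 (sym x≡js))))

  -- if k = n - 1 and l is the last step using the largest smaller point, then
  -- j_l = i_l + 1: otherwise no transposition at all would move i_l + 1
  last-max-adjacent : k ≡ m → (∀ (s : Fin k) → i_ s ≤ i) → (∀ (s : Fin k) → i_ s ≡ i → s ≤ l) →
                      toℕ j ≡ toℕ i + 1
  last-max-adjacent k≡m below-i last with toℕ j ℕ.≟ toℕ i + 1
  ... | yes j≡i+1 = j≡i+1
  ... | no  j≢i+1 = ⊥-elim (no-fixed-point k≡m x x≢0 (prodL-fixes (prefix k) x (all-take γ k (λ s _ → untouched s))))
    where
    i+1<j : suc (toℕ i) <ℕ toℕ j
    i+1<j = ℕₚ.≤∧≢⇒< (i<j l) (λ i+1≡j → j≢i+1 (trans (sym i+1≡j) (ℕₚ.+-comm 1 (toℕ i))))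
    i+1<n : suc (toℕ i) <ℕ n
    i+1<n = ℕₚ.<-trans i+1<j (toℕ<n j)
    x : Fin n
    x = fromℕ< i+1<n
    x-next : IsNext x
    x-next = trans (toℕ-fromℕ< i+1<n) (ℕₚ.+-comm 1 (toℕ i))
    x≢0 : x ≢ zero
    x≢0 x≡0 = ℕₚ.1+n≢0 (trans (sym (toℕ-fromℕ< i+1<n)) (cong toℕ x≡0))
    untouched : ∀ (s : Fin k) → x ≢ i_ s × x ≢ j_ s
    untouched s = x≢is , x≢js
      where
      x≢is : x ≢ i_ s
      x≢is x≡is = ℕₚ.<⇒≱ (subst (λ z → toℕ i <ℕ toℕ z) x≡is (ℕₚ.≤-reflexive (sym (isNext-suc x-next)))) (below-i s)
      x≢js : x ≢ j_ s
      x≢js x≡js with ℕₚ.<-cmp (toℕ s) (toℕ l)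
      ... | tri< s<l _ _ = earlier-j≢next s s<l x-next (sym x≡js)
      ... | tri≈ _ s≡l _ = j≢i+1 (trans (cong (λ r → toℕ (j_ r)) (sym (Finₚ.toℕ-injective s≡l)))
                                        (trans (cong toℕ (sym x≡js)) x-next))
      ... | tri> _ _ l<s = ℕₚ.<⇒≱ l<s (last s (Finₚ.≤-antisym (below-i s) i≤is))
        where
        -- (i_l , j_l) does not separate i_s from j_s = i_l + 1 ∈ [i_l , j_l)
        i≤is : i ≤ i_ s
        i≤is = proj₁ (proj₂ (noncrossing l s l<s)
                 (subst (Covers (i , j)) x≡js (ℕₚ.<⇒≤ (subst (toℕ i <ℕ_) (sym (isNext-suc x-next)) ℕₚ.≤-refl) ,
                                               subst (_<ℕ toℕ j) (sym (isNext-suc x-next)) i+1<j)))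

lemma3p1 : ∀ (n k : ℕ) (γ : Vec (Fin n × Fin n) k) → InΣ n k γ → (l : Fin k) →
    let σ  = partialProd γ (toℕ l)
        il = proj₁ (lookup γ l)
        jl = proj₂ (lookup γ l)
    in
    ( (∀ y → InCycle σ jl y → il < y)
      × InCycle σ il il
      × (∀ y → InCycle σ il y → (∀ z → InCycle σ jl z → y < z) → y ≤ il) )
    × ( InCycle σ jl jl × (∀ y → InCycle σ jl y → y ≤ jl) )
    × (∀ (x : Fin n) → toℕ x ≡ toℕ il + 1 → ∀ y → InCycle σ x y → il < y)
    × (∀ (x : Fin n) → toℕ x ≡ toℕ il + 1 →
         (∀ (s : Fin k) → toℕ s <ℕ toℕ l → proj₁ (lookup γ s) ≢ x) →
         ∀ y → (InCycle σ x y ⇔ y ≡ x))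
    × (k ≡ n ∸ 1 →
       (∀ (s : Fin k) → proj₁ (lookup γ s) ≤ il) →
       (∀ (s : Fin k) → proj₁ (lookup γ s) ≡ il → s ≤ l) →
       toℕ jl ≡ toℕ il + 1)
lemma3p1 zero    k γ γ∈Σ l with proj₁ (lookup γ l)
... | ()
lemma3p1 (suc m) k γ γ∈Σ l =
  (  (λ y c → proj₁ (cycle⊆J j∈J c)) , (zero , refl) , largest-below-cycle-j )
  , ((zero , refl) , (λ y c → proj₂ (cycle⊆J j∈J c)))
  , (λ x x-next y c → proj₁ (cycle⊆J (next∈J x-next) c))
  , (λ x x-next not-i y → mk⇔ (inCycle-fixed σ (next-fixed x-next not-i)) (λ { refl → zero , refl }))
  , last-max-adjacent
  where
  open Step γ γ∈Σ l
  cycle⊆J : ∀ {x y} → J x → InCycle σ x y → J y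
  cycle⊆J x∈J c = inCycle-preserves σ-preserves c x∈J
  -- a point of the cycle of i_l below j_l is not in (i_l , j_l], so it is ≤ i_l
  largest-below-cycle-j : ∀ y → InCycle σ i y → (∀ z → InCycle σ j z → y < z) → y ≤ i
  largest-below-cycle-j y c below with <-or-≥ (toℕ i) (toℕ y)
  ... | inj₁ i<y = ⊥-elim (cycle-i-outside c (i<y , ℕₚ.<⇒≤ (below j (zero , refl))))
  ... | inj₂ y≤i = y≤i
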